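{- Let $n\ge 3$ be odd and let $D\subseteq\{0,1,\dots,n-1\}$ with $|D|=2$. Then the unidirectional cycle $\overrightarrow{C_n}$ is $(\{0,1,\dots,n-1\}\setminus D)$-antimagic.
   Context: The unidirectional cycle $\overrightarrow{C_n}$ has vertices $v_1,\dots,v_n$ and arcs $(v_i,v_{i+1})$ for $1\le i\le n-1$ and $(v_n,v_1)$, so $d(v_i,v_j)=(j-i)\bmod n$, where $d(u,y)$ is the length of a shortest directed path. For a set $E$ of distances, $N_E(v)=\{y:d(v,y)\in E\}$; a bijection $f:V\to\{1,\dots,n\}$ is $E$-antimagic if $\omega_E(v)=\sum_{y\in N_E(v)}f(y)$ are pairwise distinct; the graph is $E$-antimagic if such a bijection exists. -}

module Defs where

open import Data.Nat using (ℕ; suc; _+_; _∸_; _%_; NonZero)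
open import Data.Nat.DivMod using (m%n<n)
open import Data.Fin using (Fin; toℕ; fromℕ<)
open import Data.Fin.Subset using (Subset; _∈_)
open import Data.Fin.Subset.Properties using (_∈?_)
open import Data.List using (List; map; filter)
open import Data.Nat.ListAction using (sum)
open import Data.List.Base using (allFin)
open import Function.Bundles using (_⤖_)
open import Function.Definitions using (Injective)
open import Relation.Binary.PropositionalEquality using (_≡_)

-- Vertices of the unidirectional cycle C⃗ₙ are Fin n; the vertex v_{i+1}
-- of the paper is the element i : Fin n.  Arcs are i → i+1 (mod n).
-- Directed distance d(v_i , v_j) = (j - i) mod n, computed as (j + (n - i)) mod n.
distF : (n : ℕ) → .{{_ : NonZero n}} → Fin n → Fin n → Fin n
distF n i j = fromℕ< (m%n<n (toℕ j + (n ∸ toℕ i)) n)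

N : (n : ℕ) → .{{_ : NonZero n}} → Subset n → Fin n → List (Fin n)
N n E v = filter (λ y → distF n v y ∈? E) (allFin n)

-- A labeling f : V → {1,…,n} is encoded as g : Fin n → Fin n with f(y) = toℕ (g y) + 1.
label : {n : ℕ} → (Fin n → Fin n) → Fin n → ℕ
label g y = suc (toℕ (g y))

ω : (n : ℕ) → .{{_ : NonZero n}} → Subset n → (Fin n → Fin n) → Fin n → ℕ
ω n E g v = sum (map (label g) (N n E v))

IsAntimagic : (n : ℕ) → .{{_ : NonZero n}} → Subset n → Set
IsAntimagic n E = Σ (Fin n ⤖ Fin n) λ f → Injective _≡_ _≡_ (ω n E (Bijection.to f))
  where open import Data.Product using (Σ)
        open import Function.Bundles using (Bijection)

-- Label every vertex by itself (f(vᵢ) = i).  A vertex v sees every vertex except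
-- v + a and v + b, so ω(v) = T − f(v + a) − f(v + b) with T the total label sum, and
-- ω(v) is determined by the residue sum (v + a) mod n + (v + b) mod n.  That sum
-- equals 2v + a + b − q·n for some quotient q, so two vertices with the same weight
-- satisfy 2w = 2v + k·n; parity (n odd) rules out k = 1 and size (v, w < n) rules
-- out k ≥ 2, hence v = w.
module Submission where

open import Defs
open import Data.Bool using (if_then_else_)
open import Data.Fin as F using (Fin; toℕ; fromℕ<)
open import Data.Fin.Properties using (toℕ-fromℕ<; toℕ-injective; toℕ<n; suc-injective) renaming (_≟_ to _≟ᶠ_)
open import Data.Fin.Subset using (Subset; ∁; ⁅_⁆; _∪_)
open import Data.Fin.Subset.Properties using (_∈?_; x∈∁p⇒x∉p; x∉p⇒x∈∁p; p⊆p∪q; q⊆p∪q; x∈p∪q⁻; x∈⁅x⁆; x∈⁅y⁆⇒x≡y)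
open import Data.List using (List; []; _∷_; map; filter; tabulate; allFin)
open import Data.List.Properties using (map-tabulate; map-cong)
open import Data.Nat using (ℕ; zero; suc; _+_; _*_; _∸_; _%_; _/_; _≤_; _<_; NonZero)
open import Data.Nat.DivMod using (m%n<n; m≡m%n+[m/n]*n; %-distribˡ-+; m%n%n≡m%n; [m+n]%n≡m%n; m<n⇒m%n≡m)
open import Data.Nat.Divisibility using (_∣_; ∣m+n∣m⇒∣n; m∣m*n)
open import Data.Nat.ListAction using (sum)
open import Data.Nat.Properties
  using (+-identityʳ; +-suc; +-cancelʳ-≡; +-cancelˡ-≡; *-cancelˡ-≡; *-monoʳ-<; *-monoˡ-≤;
         m≤m+n; m≤n+m; m+[n∸m]≡n; <⇒≤; <⇒≢; ≤-total; module ≤-Reasoning)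
open import Data.Nat.Solver using (module +-*-Solver)
open import Data.Product using (_,_)
open import Data.Sum using ([_,_]′; inj₁; inj₂)
open import Function using (id; _∘_)
open import Function.Construct.Identity using (⤖-id)
open import Function.Definitions using (Injective)
open import Relation.Nullary using (¬_; Dec; yes; no; does; contradiction)
open import Relation.Unary using (Pred; Decidable)
open import Relation.Binary.PropositionalEquality
  using (_≡_; _≢_; refl; sym; trans; cong; cong₂; subst; module ≡-Reasoning)

open +-*-Solver using (solve; _:+_; _:*_; _:=_; con)

_when_ : ∀ {p} {P : Set p} → ℕ → Dec P → ℕ
m when P? = if does P? then m else 0

infix 7 _when_

sum-map-filter : ∀ {p} {A : Set} {P : Pred A p} (h : A → ℕ) (P? : Decidable P) (xs : List A) →
                 sum (map h (filter P? xs)) ≡ sum (map (λ y → h y when P? y) xs)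
sum-map-filter h P? []       = refl
sum-map-filter h P? (x ∷ xs) with P? x
... | yes _ = cong (h x +_) (sum-map-filter h P? xs)
... | no  _ = sum-map-filter h P? xs

sum-map-+ : ∀ {A : Set} (f g : A → ℕ) (xs : List A) →
            sum (map (λ y → f y + g y) xs) ≡ sum (map f xs) + sum (map g xs)
sum-map-+ f g []       = refl
sum-map-+ f g (x ∷ xs) = trans (cong (f x + g x +_) (sum-map-+ f g xs))
  (solve 4 (λ a b s t → a :+ b :+ (s :+ t) := a :+ s :+ (b :+ t)) refl (f x) (g x) (sum (map f xs)) (sum (map g xs)))

sum-tabulate-zero : ∀ {n} (f : Fin n → ℕ) → (∀ y → f y ≡ 0) → sum (tabulate f) ≡ 0
sum-tabulate-zero {zero}  f f≡0 = refl
sum-tabulate-zero {suc n} f f≡0 = cong₂ _+_ (f≡0 F.zero) (sum-tabulate-zero (f ∘ F.suc) (f≡0 ∘ F.suc))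

sum-tabulate-point : ∀ {n} (f : Fin n → ℕ) p → (∀ y → y ≢ p → f y ≡ 0) → sum (tabulate f) ≡ f p
sum-tabulate-point f F.zero f≡0 =
  trans (cong (f F.zero +_) (sum-tabulate-zero (f ∘ F.suc) (λ y → f≡0 (F.suc y) λ ())))
        (+-identityʳ (f F.zero))
sum-tabulate-point f (F.suc p) f≡0 =
  cong₂ _+_ (f≡0 F.zero λ ()) (sum-tabulate-point (f ∘ F.suc) p λ y y≢p → f≡0 (F.suc y) (y≢p ∘ suc-injective))

sum-allFin-point : ∀ {n} (f : Fin n → ℕ) p → (∀ y → y ≢ p → f y ≡ 0) → sum (map f (allFin n)) ≡ f p
sum-allFin-point f p f≡0 = trans (cong sum (map-tabulate id f)) (sum-tabulate-point f p f≡0)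

when-∁-pair : ∀ {n} {a b : Fin n} → a ≢ b → ∀ z m →
              m when (z ∈? ∁ (⁅ a ⁆ ∪ ⁅ b ⁆)) + (m when (z ≟ᶠ a) + m when (z ≟ᶠ b)) ≡ m
when-∁-pair {a = a} {b} a≢b z m with z ∈? ∁ (⁅ a ⁆ ∪ ⁅ b ⁆) | z ≟ᶠ a | z ≟ᶠ b
... | yes z∈ | yes refl | _        = contradiction (p⊆p∪q ⁅ b ⁆ (x∈⁅x⁆ a)) (x∈∁p⇒x∉p z∈)
... | yes z∈ | no _     | yes refl = contradiction (q⊆p∪q ⁅ a ⁆ ⁅ b ⁆ (x∈⁅x⁆ b)) (x∈∁p⇒x∉p z∈)
... | yes _  | no _     | no _     = +-identityʳ m
... | no _   | yes refl | yes a≡b  = contradiction a≡b a≢b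
... | no _   | yes _    | no _     = +-identityʳ m
... | no _   | no _     | yes _    = refl
... | no z∉  | no z≢a   | no z≢b   =
  contradiction (x∉p⇒x∈∁p ([ z≢a ∘ x∈⁅y⁆⇒x≡y a , z≢b ∘ x∈⁅y⁆⇒x≡y b ]′ ∘ x∈p∪q⁻ ⁅ a ⁆ ⁅ b ⁆)) z∉

[m%n+o]%n≡[m+o]%n : ∀ m o n .{{_ : NonZero n}} → (m % n + o) % n ≡ (m + o) % n
[m%n+o]%n≡[m+o]%n m o n = begin
  (m % n + o) % n         ≡⟨ %-distribˡ-+ (m % n) o n ⟩
  (m % n % n + o % n) % n ≡⟨ cong (λ t → (t + o % n) % n) (m%n%n≡m%n m n) ⟩
  (m % n + o % n) % n     ≡⟨ %-distribˡ-+ m o n ⟨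
  (m + o) % n             ∎
  where open ≡-Reasoning

[m+o%n]%n≡[m+o]%n : ∀ m o n .{{_ : NonZero n}} → (m + o % n) % n ≡ (m + o) % n
[m+o%n]%n≡[m+o]%n m o n = begin
  (m + o % n) % n         ≡⟨ %-distribˡ-+ m (o % n) n ⟩
  (m % n + o % n % n) % n ≡⟨ cong (λ t → (m % n + t) % n) (m%n%n≡m%n o n) ⟩
  (m % n + o % n) % n     ≡⟨ %-distribˡ-+ m o n ⟨
  (m + o) % n             ∎
  where open ≡-Reasoning

2w≡2v+kn⇒k≡0 : ∀ {n v w} k → ¬ 2 ∣ n → w < n → 2 * w ≡ 2 * v + k * n → k ≡ 0
2w≡2v+kn⇒k≡0 zero _ _ _ = refl
2w≡2v+kn⇒k≡0 {n} {v} {w} 1 n-odd _ 2w≡2v+n = contradiction 2∣n n-odd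
  where
  2∣n : 2 ∣ n
  2∣n = subst (2 ∣_) (+-identityʳ n) (∣m+n∣m⇒∣n (subst (2 ∣_) 2w≡2v+n (m∣m*n w)) (m∣m*n v))
2w≡2v+kn⇒k≡0 {n} {v} {w} (suc (suc k)) _ w<n 2w≡2v+kn = contradiction 2w≡2v+kn (<⇒≢ (begin-strict
  2 * w                   <⟨ *-monoʳ-< 2 w<n ⟩
  2 * n                   ≤⟨ *-monoˡ-≤ n (m≤m+n 2 k) ⟩
  (2 + k) * n             ≤⟨ m≤n+m _ (2 * v) ⟩
  2 * v + (2 + k) * n     ∎))
  where open ≤-Reasoning

2*-cancel-mod-odd-≤ : ∀ {n c S x y v w} → ¬ 2 ∣ n → w < n → x ≤ y →
                      2 * v + c ≡ S + x * n → 2 * w + c ≡ S + y * n → w ≡ v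
2*-cancel-mod-odd-≤ {n} {c} {S} {x} {y} {v} {w} n-odd w<n x≤y 2v+c≡S+xn 2w+c≡S+yn =
  *-cancelˡ-≡ w v 2 (begin
    2 * w             ≡⟨ 2w≡2v+kn ⟩
    2 * v + k * n     ≡⟨ cong (λ t → 2 * v + t * n) (2w≡2v+kn⇒k≡0 {v = v} k n-odd w<n 2w≡2v+kn) ⟩
    2 * v + 0         ≡⟨ +-identityʳ (2 * v) ⟩
    2 * v             ∎)
  where
  open ≡-Reasoning
  k : ℕ
  k = y ∸ x
  2w≡2v+kn : 2 * w ≡ 2 * v + k * n
  2w≡2v+kn = +-cancelʳ-≡ c _ _ (begin
    2 * w + c         ≡⟨ 2w+c≡S+yn ⟩
    S + y * n         ≡⟨ cong (λ t → S + t * n) (m+[n∸m]≡n x≤y) ⟨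
    S + (x + k) * n   ≡⟨ solve 4 (λ S x k n → S :+ (x :+ k) :* n := S :+ x :* n :+ k :* n) refl S x k n ⟩
    S + x * n + k * n ≡⟨ cong (_+ k * n) 2v+c≡S+xn ⟨
    2 * v + c + k * n ≡⟨ solve 3 (λ u c m → u :+ c :+ m := u :+ m :+ c) refl (2 * v) c (k * n) ⟩
    2 * v + k * n + c ∎)

-- The hypotheses say 2v ≡ 2w (mod n), and 2 is invertible modulo an odd n.
2*-cancel-mod-odd : ∀ {n c S x y v w} → ¬ 2 ∣ n → v < n → w < n →
                    2 * v + c ≡ S + x * n → 2 * w + c ≡ S + y * n → v ≡ w
2*-cancel-mod-odd {x = x} {y} n-odd v<n w<n 2v+c≡S+xn 2w+c≡S+yn with ≤-total x y
... | inj₁ x≤y = sym (2*-cancel-mod-odd-≤ n-odd w<n x≤y 2v+c≡S+xn 2w+c≡S+yn)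
... | inj₂ y≤x = 2*-cancel-mod-odd-≤ n-odd v<n y≤x 2w+c≡S+yn 2v+c≡S+xn

2v+[a+b]≡residues+quotients*n : ∀ n .{{_ : NonZero n}} v a b →
  2 * v + (a + b) ≡ (v + a) % n + (v + b) % n + ((v + a) / n + (v + b) / n) * n
2v+[a+b]≡residues+quotients*n n v a b = begin
  2 * v + (a + b)
    ≡⟨ solve 3 (λ v a b → con 2 :* v :+ (a :+ b) := v :+ a :+ (v :+ b)) refl v a b ⟩
  (v + a) + (v + b)
    ≡⟨ cong₂ _+_ (m≡m%n+[m/n]*n (v + a) n) (m≡m%n+[m/n]*n (v + b) n) ⟩
  ((v + a) % n + (v + a) / n * n) + ((v + b) % n + (v + b) / n * n)
    ≡⟨ solve 5 (λ r s q t n → r :+ q :* n :+ (s :+ t :* n) := r :+ s :+ (q :+ t) :* n) refl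
         ((v + a) % n) ((v + b) % n) ((v + a) / n) ((v + b) / n) n ⟩
  (v + a) % n + (v + b) % n + ((v + a) / n + (v + b) / n) * n ∎
  where open ≡-Reasoning

residue-sum-injective : ∀ {n} .{{_ : NonZero n}} → ¬ 2 ∣ n → ∀ a b {v w} → v < n → w < n →
  (v + a) % n + (v + b) % n ≡ (w + a) % n + (w + b) % n → v ≡ w
residue-sum-injective {n} n-odd a b {v} {w} v<n w<n residues≡ =
  2*-cancel-mod-odd {x = quotients v} {quotients w} n-odd v<n w<n
    (trans (2v+[a+b]≡residues+quotients*n n v a b) (cong (_+ quotients v * n) residues≡))
    (2v+[a+b]≡residues+quotients*n n w a b)
  where
  quotients : ℕ → ℕ
  quotients u = (u + a) / n + (u + b) / n

module Shift (n : ℕ) .{{_ : NonZero n}} where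

  infixl 6 _⊕_

  _⊕_ : Fin n → Fin n → Fin n
  v ⊕ c = fromℕ< (m%n<n (toℕ v + toℕ c) n)

  toℕ-⊕ : ∀ v c → toℕ (v ⊕ c) ≡ (toℕ v + toℕ c) % n
  toℕ-⊕ v c = toℕ-fromℕ< _

  toℕ-distF : ∀ v y → toℕ (distF n v y) ≡ (toℕ y + (n ∸ toℕ v)) % n
  toℕ-distF v y = toℕ-fromℕ< _

  x+[n∸v]+v≡x+n : ∀ x v → v ≤ n → x + (n ∸ v) + v ≡ x + n
  x+[n∸v]+v≡x+n x v v≤n = begin
    x + (n ∸ v) + v ≡⟨ solve 3 (λ x d v → x :+ d :+ v := x :+ (v :+ d)) refl x (n ∸ v) v ⟩
    x + (v + (n ∸ v)) ≡⟨ cong (x +_) (m+[n∸m]≡n v≤n) ⟩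
    x + n ∎
    where open ≡-Reasoning

  toℕ+n%n≡toℕ : ∀ (x : Fin n) → (toℕ x + n) % n ≡ toℕ x
  toℕ+n%n≡toℕ x = trans ([m+n]%n≡m%n (toℕ x) n) (m<n⇒m%n≡m (toℕ<n x))

  distF-⊕ : ∀ v c → distF n v (v ⊕ c) ≡ c
  distF-⊕ v c = toℕ-injective (begin
    toℕ (distF n v (v ⊕ c))                     ≡⟨ toℕ-distF v (v ⊕ c) ⟩
    (toℕ (v ⊕ c) + (n ∸ toℕ v)) % n             ≡⟨ cong (λ t → (t + (n ∸ toℕ v)) % n) (toℕ-⊕ v c) ⟩
    ((toℕ v + toℕ c) % n + (n ∸ toℕ v)) % n     ≡⟨ [m%n+o]%n≡[m+o]%n (toℕ v + toℕ c) (n ∸ toℕ v) n ⟩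
    (toℕ v + toℕ c + (n ∸ toℕ v)) % n
      ≡⟨ cong (_% n) (solve 3 (λ v c d → v :+ c :+ d := c :+ d :+ v) refl (toℕ v) (toℕ c) (n ∸ toℕ v)) ⟩
    (toℕ c + (n ∸ toℕ v) + toℕ v) % n           ≡⟨ cong (_% n) (x+[n∸v]+v≡x+n (toℕ c) (toℕ v) (<⇒≤ (toℕ<n v))) ⟩
    (toℕ c + n) % n                             ≡⟨ toℕ+n%n≡toℕ c ⟩
    toℕ c                                       ∎)
    where open ≡-Reasoning

  ⊕-distF : ∀ v y → v ⊕ distF n v y ≡ y
  ⊕-distF v y = toℕ-injective (begin
    toℕ (v ⊕ distF n v y)                       ≡⟨ toℕ-⊕ v (distF n v y) ⟩
    (toℕ v + toℕ (distF n v y)) % n             ≡⟨ cong (λ t → (toℕ v + t) % n) (toℕ-distF v y) ⟩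
    (toℕ v + (toℕ y + (n ∸ toℕ v)) % n) % n     ≡⟨ [m+o%n]%n≡[m+o]%n (toℕ v) (toℕ y + (n ∸ toℕ v)) n ⟩
    (toℕ v + (toℕ y + (n ∸ toℕ v))) % n
      ≡⟨ cong (_% n) (solve 3 (λ v y d → v :+ (y :+ d) := y :+ d :+ v) refl (toℕ v) (toℕ y) (n ∸ toℕ v)) ⟩
    (toℕ y + (n ∸ toℕ v) + toℕ v) % n           ≡⟨ cong (_% n) (x+[n∸v]+v≡x+n (toℕ y) (toℕ v) (<⇒≤ (toℕ<n v))) ⟩
    (toℕ y + n) % n                             ≡⟨ toℕ+n%n≡toℕ y ⟩
    toℕ y                                       ∎)
    where open ≡-Reasoning

  module _ {a b : Fin n} (a≢b : a ≢ b) (g : Fin n → Fin n) where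

    private
      E : Subset n
      E = ∁ (⁅ a ⁆ ∪ ⁅ b ⁆)

      h : Fin n → ℕ
      h = label g

    sum-when-distF≡ : ∀ v c → sum (map (λ y → h y when (distF n v y ≟ᶠ c)) (allFin n)) ≡ h (v ⊕ c)
    sum-when-distF≡ v c = trans (sum-allFin-point _ (v ⊕ c) vanishes-off-v⊕c) value-at-v⊕c
      where
      value-at-v⊕c : h (v ⊕ c) when (distF n v (v ⊕ c) ≟ᶠ c) ≡ h (v ⊕ c)
      value-at-v⊕c with distF n v (v ⊕ c) ≟ᶠ c
      ... | yes _ = refl
      ... | no ne = contradiction (distF-⊕ v c) ne
      vanishes-off-v⊕c : ∀ y → y ≢ v ⊕ c → h y when (distF n v y ≟ᶠ c) ≡ 0
      vanishes-off-v⊕c y y≢v⊕c with distF n v y ≟ᶠ c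
      ... | yes d≡c = contradiction (trans (sym (⊕-distF v y)) (cong (v ⊕_) d≡c)) y≢v⊕c
      ... | no _    = refl

    ω+skipped≡total : ∀ v → ω n E g v + (h (v ⊕ a) + h (v ⊕ b)) ≡ sum (map h (allFin n))
    ω+skipped≡total v = begin
      ω n E g v + (h (v ⊕ a) + h (v ⊕ b))
        ≡⟨ cong₂ (λ s t → s + (t + h (v ⊕ b))) (sum-map-filter h (λ y → d y ∈? E) (allFin n)) (sym (sum-when-distF≡ v a)) ⟩
      Σ (λ y → h y when (d y ∈? E)) + (Σ (λ y → h y when (d y ≟ᶠ a)) + h (v ⊕ b))
        ≡⟨ cong (λ t → Σ (λ y → h y when (d y ∈? E)) + (Σ (λ y → h y when (d y ≟ᶠ a)) + t)) (sum-when-distF≡ v b) ⟨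
      Σ (λ y → h y when (d y ∈? E)) + (Σ (λ y → h y when (d y ≟ᶠ a)) + Σ (λ y → h y when (d y ≟ᶠ b)))
        ≡⟨ cong (Σ (λ y → h y when (d y ∈? E)) +_) (sum-map-+ _ _ (allFin n)) ⟨
      Σ (λ y → h y when (d y ∈? E)) + Σ (λ y → h y when (d y ≟ᶠ a) + h y when (d y ≟ᶠ b))
        ≡⟨ sum-map-+ _ _ (allFin n) ⟨
      Σ (λ y → h y when (d y ∈? E) + (h y when (d y ≟ᶠ a) + h y when (d y ≟ᶠ b)))
        ≡⟨ cong sum (map-cong (λ y → when-∁-pair a≢b (d y) (h y)) (allFin n)) ⟩
      Σ h ∎
      where
      open ≡-Reasoning
      d : Fin n → Fin n
      d = distF n v
      Σ : (Fin n → ℕ) → ℕ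
      Σ f = sum (map f (allFin n))

    skipped-labels-determined : ∀ {v w} → ω n E g v ≡ ω n E g w →
                                h (v ⊕ a) + h (v ⊕ b) ≡ h (w ⊕ a) + h (w ⊕ b)
    skipped-labels-determined {v} {w} ωv≡ωw = +-cancelˡ-≡ (ω n E g v) _ _
      (trans (ω+skipped≡total v) (trans (sym (ω+skipped≡total w)) (cong (_+ _) (sym ωv≡ωw))))

  ⊕-pair-injective : ¬ 2 ∣ n → ∀ a b {v w} →
                     toℕ (v ⊕ a) + toℕ (v ⊕ b) ≡ toℕ (w ⊕ a) + toℕ (w ⊕ b) → v ≡ w
  ⊕-pair-injective n-odd a b {v} {w} sums≡ rewrite toℕ-⊕ v a | toℕ-⊕ v b | toℕ-⊕ w a | toℕ-⊕ w b =
    toℕ-injective (residue-sum-injective n-odd (toℕ a) (toℕ b) (toℕ<n v) (toℕ<n w) sums≡)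

mainTheorem20 : (n : ℕ) → .{{_ : NonZero n}} → 3 ≤ n → ¬ (2 ∣ n) →
    (a b : Fin n) → a ≢ b →
    IsAntimagic n (∁ (⁅ a ⁆ ∪ ⁅ b ⁆))
mainTheorem20 n _ n-odd a b a≢b = ⤖-id (Fin n) , ω-injective
  where
  open Shift n
  suc+suc≡2+ : ∀ x y → suc x + suc y ≡ 2 + (x + y)
  suc+suc≡2+ x y = cong suc (+-suc x y)
  ω-injective : Injective _≡_ _≡_ (ω n (∁ (⁅ a ⁆ ∪ ⁅ b ⁆)) id)
  ω-injective ωv≡ωw = ⊕-pair-injective n-odd a b (+-cancelˡ-≡ 2 _ _
    (trans (sym (suc+suc≡2+ _ _)) (trans (skipped-labels-determined a≢b id ωv≡ωw) (suc+suc≡2+ _ _))))
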